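{- Let $r>1$ be an integer and $q$ a power of an odd prime with $q\equiv 1\pmod r$; let $\zeta\in\mathbb{F}_q^{\ast}$ be an element of order $r$. Let $m,d$ be positive integers with $q-1=md$, $d$ a multiple of $r$, and $\varphi(m)\ge r$. Let $u_0,u_1,\ldots,u_{r-1}\in\mathbb{F}_q^{\ast}$ all have multiplicative order $m$. Let $G(x)=a_{r-1}x^{r-1}+\cdots+a_1x+a_0\in\mathbb{F}_q[x]$ be the (unique) polynomial of degree at most $r-1$ with $G(\zeta^k)=u_k$ for $k=0,1,\ldots,r-1$, i.e. $\sum_{s=0}^{r-1}a_s\zeta^{ks}=u_k$. Let $\ell=(q-1)/r$ and $f(x)=xG(x^{\ell})$. Then: (i) $f$ is a permutation polynomial of $\mathbb{F}_q$; (ii) the permutation induced by $f$ has cycle type $1+m^d$; (iii) the inverse permutation is induced by a polynomial of the form $xG'(x^{\ell})$ (so involving the same powers of $x$ as $f$), where $G'$ is the polynomial of degree at most $r-1$ with $G'(\zeta^k)=u_k^{ -1}$ for $k=0,\ldots,r-1$.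
   Context: $\varphi$ is Euler's totient function. The order of a nonzero element means its order in $\mathbb{F}_q^{\ast}$. Cycle type $1+m^d$ means exactly one fixed point and $d$ further disjoint cycles each of length $m$. -}

module Defs where

open import Level using (0ℓ)
open import Data.Nat as ℕ using (ℕ; zero; suc; _≤_; _<_)
open import Data.Nat.GCD using (gcd)
open import Data.Fin using (Fin; toℕ)
open import Data.List using (List; length; filter; map; upTo)
open import Data.Product using (∃; _×_)
open import Relation.Binary.PropositionalEquality using (_≡_; _≢_)
open import Algebra.Core using (Op₁; Op₂)
open import Algebra.Structures using (IsCommutativeRing)
open import Function.Bundles using (_↔_)

record FiniteField (q : ℕ) : Set₁ where
  field
    Carrier : Set
    _+_ _*_ : Op₂ Carrier
    -_ : Op₁ Carrier
    0# 1# : Carrier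
    isCommutativeRing : IsCommutativeRing _≡_ _+_ _*_ -_ 0# 1#
    0≢1 : 0# ≢ 1#
    inverse : ∀ x → x ≢ 0# → ∃ λ y → x * y ≡ 1#
    enum : Fin q ↔ Carrier

  infixl 7 _*_
  infixl 6 _+_

  pow : Carrier → ℕ → Carrier
  pow x zero    = 1#
  pow x (suc n) = x * pow x n

  HasOrder : Carrier → ℕ → Set
  HasOrder x m = x ≢ 0# × 1 ≤ m × pow x m ≡ 1#
               × (∀ k → 1 ≤ k → k < m → pow x k ≢ 1#)

  sumFin : (n : ℕ) → (Fin n → Carrier) → Carrier
  sumFin zero    g = 0#
  sumFin (suc n) g = g Fin.zero + sumFin n (λ s → g (Fin.suc s))
    where import Data.Fin as Fin

  evalPoly : {r : ℕ} → (Fin r → Carrier) → Carrier → Carrier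
  evalPoly {r} a y = sumFin r (λ s → a s * pow y (toℕ s))

φ : ℕ → ℕ
φ m = length (filter (λ k → gcd k m ℕ.≟ 1) (map suc (upTo m)))

iter : {A : Set} → (A → A) → ℕ → A → A
iter f zero    x = x
iter f (suc n) x = f (iter f n x)

-- Cycle type 1 + m^d for a permutation f of a set with 1 + m*d elements:
-- exactly one fixed point, and every other point lies on a cycle of length
-- exactly m (its least period is m).  Since there are m*d non-fixed points,
-- this means exactly d cycles of length m.
CycleType1+m^ : {A : Set} → (A → A) → ℕ → Set
CycleType1+m^ {A} f m =
  (∃ λ x₀ → f x₀ ≡ x₀ × (∀ y → f y ≡ y → y ≡ x₀)
     × (∀ y → y ≢ x₀ → iter f m y ≡ y
                      × (∀ k → 1 ≤ k → k < m → iter f k y ≢ y)))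

{-# OPTIONS --safe #-}
-- For x ≠ 0 we have (xˡ)ʳ = x^(q−1) = 1, and since r · 1 ≠ 0 in F_q (r divides
-- q − 1) the r-th roots of unity are exactly the powers of ζ; so xˡ = ζᵏ and
-- f x = u_k x.  As m ∣ ℓ, multiplying by u_k does not change xˡ, hence
-- fʲ x = u_kʲ x: every x ≠ 0 lies on a cycle of length exactly m, 0 is the only
-- fixed point, and x ↦ x G′(xˡ) multiplies by u_k⁻¹ on the same classes.
module Submission where

open import Defs
open import Data.Nat as ℕ using (ℕ; _≤_; _<_; _∸_; _^_)
open import Data.Nat.Divisibility using (_∣_; divides)
open import Data.Nat.Primality using (Prime)
open import Data.Fin using (Fin; toℕ)
open import Data.Product using (∃; _×_; _,_; proj₁; proj₂)
open import Relation.Binary.PropositionalEquality using (_≡_; _≢_)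
open import Function.Definitions using (Bijective)

open import Level using (0ℓ)
open import Data.Nat using (zero; suc; z≤n; s≤s)
import Data.Nat.Properties as ℕ
open import Data.Fin using (punchIn; inject₁; fromℕ) renaming (zero to fzero; suc to fsuc)
import Data.Fin.Properties as Fin
open import Data.Empty using (⊥-elim)
open import Relation.Nullary using (Dec; yes; no)
open import Relation.Binary.PropositionalEquality using (refl; sym; trans; cong; cong₂; subst; module ≡-Reasoning)
open import Function.Base using (_∘_)
open import Function.Bundles using (Inverse; _↔_; mk↔ₛ′)
open import Function.Construct.Composition using (_↔-∘_)
open import Function.Construct.Symmetry using (↔-sym)
open import Function.Properties.Inverse using (↔⇒↣)
open import Algebra.Bundles using (CommutativeMonoid; CommutativeRing)
import Algebra.Properties.CommutativeMonoid.Sum as MonoidSum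
import Algebra.Properties.Semiring.Sum as SemiringSum
import Algebra.Properties.CommutativeSemiring.Exp as SemiringExp
import Algebra.Properties.Ring as RingProperties
import Algebra.Properties.Semiring.Mult as SemiringMult

module _ {c ℓ} (M : CommutativeMonoid c ℓ) where
  open CommutativeMonoid M using (Carrier; _≈_; reflexive) renaming (trans to ≈-trans)
  open MonoidSum M using (sum; ∑-permute; sum-cong-≗)

  sum-reindex : ∀ {n} {A : Set} (e : Fin n ↔ A) (σ : A ↔ A) (g : A → Carrier) →
                sum (g ∘ Inverse.to e) ≈ sum (g ∘ Inverse.to σ ∘ Inverse.to e)
  sum-reindex {n} e σ g = ≈-trans (∑-permute {n} {n} (g ∘ Inverse.to e) π)
                            (reflexive (sum-cong-≗ {n} λ i → cong g (Inverse.strictlyInverseˡ e _)))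
    where π = (↔-sym e ↔-∘ σ) ↔-∘ e

iter-suc : ∀ {A : Set} (f : A → A) j x → iter f (suc j) x ≡ iter f j (f x)
iter-suc f zero    x = refl
iter-suc f (suc j) x = cong f (iter-suc f j x)

iter-periodic⇒bijective : ∀ {A : Set} (f : A → A) m .{{_ : ℕ.NonZero m}} → (∀ x → iter f m x ≡ x) →
                          Bijective _≡_ _≡_ f
iter-periodic⇒bijective f (suc m) periodic = injective , surjective
  where
  injective : ∀ {x y} → f x ≡ f y → x ≡ y
  injective {x} {y} fx≡fy = begin
    x                ≡⟨ periodic x ⟨
    iter f (suc m) x ≡⟨ iter-suc f m x ⟩
    iter f m (f x)   ≡⟨ cong (iter f m) fx≡fy ⟩
    iter f m (f y)   ≡⟨ iter-suc f m y ⟨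
    iter f (suc m) y ≡⟨ periodic y ⟩
    y                ∎
    where open ≡-Reasoning
  surjective : ∀ y → ∃ λ x → ∀ {z} → z ≡ x → f z ≡ y
  surjective y = iter f m y , λ { refl → periodic y }

r*ℓ≡m*d∧r∣d⇒m∣ℓ : ∀ {r ℓ m d} .{{_ : ℕ.NonZero r}} → r ℕ.* ℓ ≡ m ℕ.* d → r ∣ d → m ∣ ℓ
r*ℓ≡m*d∧r∣d⇒m∣ℓ {r} {ℓ} {m} r*ℓ≡m*d (divides c refl) = divides c (ℕ.*-cancelʳ-≡ ℓ (c ℕ.* m) r (begin
  ℓ ℕ.* r           ≡⟨ ℕ.*-comm ℓ r ⟩
  r ℕ.* ℓ           ≡⟨ r*ℓ≡m*d ⟩
  m ℕ.* (c ℕ.* r)   ≡⟨ ℕ.*-assoc m c r ⟨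
  m ℕ.* c ℕ.* r     ≡⟨ cong (ℕ._* r) (ℕ.*-comm m c) ⟩
  c ℕ.* m ℕ.* r     ∎))
  where open ≡-Reasoning

1<φ⇒1<n : ∀ n → 1 < φ n → 1 < n
1<φ⇒1<n (suc zero)    (s≤s ())
1<φ⇒1<n (suc (suc n)) _ = s≤s (s≤s z≤n)

module FieldProperties {q : ℕ} (F : FiniteField q) where
  open FiniteField F

  commutativeRing : CommutativeRing 0ℓ 0ℓ
  commutativeRing = record { isCommutativeRing = isCommutativeRing }

  open CommutativeRing commutativeRing
    using (*-assoc; *-comm; *-identityˡ; *-identityʳ; zeroˡ; zeroʳ; +-identityˡ; +-identityʳ;
           +-comm; +-assoc; -‿inverseʳ; -‿inverseˡ; ring; semiring; commutativeSemiring;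
           +-commutativeMonoid; *-commutativeMonoid)

  _≟_ : (x y : Carrier) → Dec (x ≡ y)
  _≟_ = Fin.inj⇒≟ (↔⇒↣ (↔-sym enum))

  open RingProperties ring using (+-cancelˡ; +-cancelʳ)
  open SemiringExp commutativeSemiring using (^-assocʳ; ^-distrib-*) renaming (_^_ to _^ᴿ_)

  *-cancelˡ : ∀ x {y z} → x ≢ 0# → x * y ≡ x * z → y ≡ z
  *-cancelˡ x {y} {z} x≢0 xy≡xz = begin
    y             ≡⟨ insert y ⟩
    x⁻¹ * (x * y) ≡⟨ cong (x⁻¹ *_) xy≡xz ⟩
    x⁻¹ * (x * z) ≡⟨ insert z ⟨
    z             ∎
    where
    open ≡-Reasoning
    x⁻¹ = proj₁ (inverse x x≢0)
    insert : ∀ w → w ≡ x⁻¹ * (x * w)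
    insert w = begin
      w             ≡⟨ *-identityˡ w ⟨
      1# * w        ≡⟨ cong (_* w) (trans (sym (proj₂ (inverse x x≢0))) (*-comm x x⁻¹)) ⟩
      x⁻¹ * x * w   ≡⟨ *-assoc x⁻¹ x w ⟩
      x⁻¹ * (x * w) ∎

  *-cancelʳ : ∀ x {y z} → x ≢ 0# → y * x ≡ z * x → y ≡ z
  *-cancelʳ x {y} {z} x≢0 yx≡zx = *-cancelˡ x x≢0 (trans (*-comm x y) (trans yx≡zx (*-comm z x)))

  *-nonzero : ∀ {x y} → x ≢ 0# → y ≢ 0# → x * y ≢ 0#
  *-nonzero {x} x≢0 y≢0 xy≡0 = y≢0 (*-cancelˡ x x≢0 (trans xy≡0 (sym (zeroʳ x))))

  1≢0 : 1# ≢ 0#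
  1≢0 = 0≢1 ∘ sym

  pow≡^ : ∀ x n → pow x n ≡ x ^ᴿ n
  pow≡^ x zero    = refl
  pow≡^ x (suc n) = cong (x *_) (pow≡^ x n)

  pow-* : ∀ x m n → pow (pow x m) n ≡ pow x (m ℕ.* n)
  pow-* x m n rewrite pow≡^ (pow x m) n | pow≡^ x m | pow≡^ x (m ℕ.* n) = ^-assocʳ x m n

  pow-distrib-* : ∀ x y n → pow (x * y) n ≡ pow x n * pow y n
  pow-distrib-* x y n rewrite pow≡^ (x * y) n | pow≡^ x n | pow≡^ y n = ^-distrib-* x y n

  pow-1# : ∀ n → pow 1# n ≡ 1#
  pow-1# zero    = refl
  pow-1# (suc n) = trans (*-identityˡ _) (pow-1# n)

  pow-comm : ∀ x m n → pow (pow x m) n ≡ pow (pow x n) m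
  pow-comm x m n = trans (pow-* x m n) (trans (cong (pow x) (ℕ.*-comm m n)) (sym (pow-* x n m)))

  open SemiringSum semiring
    using (sum; sum-cong-≗; ∑-comm; ∑-distrib-+; *-distribˡ-sum; sum-replicate; sum-replicate-zero; sum-init-last)
  open SemiringMult semiring using (×1-homo-*) renaming (_×_ to _·_)
  module Π = MonoidSum *-commutativeMonoid renaming (sum to product)

  pow≡product : ∀ x n → pow x n ≡ Π.product {n} (λ _ → x)
  pow≡product x n = trans (pow≡^ x n) (sym (Π.sum-replicate n))

  product-nonzero : ∀ {n} (g : Fin n → Carrier) → (∀ i → g i ≢ 0#) → Π.product g ≢ 0#
  product-nonzero {zero}  g g≢0 = 1≢0
  product-nonzero {suc n} g g≢0 = *-nonzero (g≢0 fzero) (product-nonzero (g ∘ fsuc) (g≢0 ∘ fsuc))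

  *-bijection : ∀ x → x ≢ 0# → Carrier ↔ Carrier
  *-bijection x x≢0 =
    mk↔ₛ′ (x *_) (x⁻¹ *_) (cancel x x⁻¹ xx⁻¹≡1) (cancel x⁻¹ x (trans (*-comm x⁻¹ x) xx⁻¹≡1))
    where
    x⁻¹ = proj₁ (inverse x x≢0)
    xx⁻¹≡1 = proj₂ (inverse x x≢0)
    cancel : ∀ a b → a * b ≡ 1# → ∀ y → a * (b * y) ≡ y
    cancel a b ab≡1 y = trans (sym (*-assoc a b y)) (trans (cong (_* y) ab≡1) (*-identityˡ y))

  +-bijection : Carrier → Carrier ↔ Carrier
  +-bijection c = mk↔ₛ′ (_+ c) (_+ - c) (cancel (- c) c (-‿inverseˡ c)) (cancel c (- c) (-‿inverseʳ c))
    where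
    cancel : ∀ a b → a + b ≡ 0# → ∀ y → y + a + b ≡ y
    cancel a b a+b≡0 y = trans (+-assoc y a b) (trans (cong (y +_) a+b≡0) (+-identityʳ y))

  zero↦one : Carrier → Carrier
  zero↦one x with x ≟ 0#
  ... | yes _ = 1#
  ... | no  _ = x

  zero↦one-0# : zero↦one 0# ≡ 1#
  zero↦one-0# with 0# ≟ 0#
  ... | yes _   = refl
  ... | no 0≢0 = ⊥-elim (0≢0 refl)

  zero↦one-nonzero : ∀ {x} → x ≢ 0# → zero↦one x ≡ x
  zero↦one-nonzero {x} x≢0 with x ≟ 0#
  ... | yes x≡0 = ⊥-elim (x≢0 x≡0)
  ... | no  _   = refl

  module Enumeration {n : ℕ} (e : Fin (suc n) ↔ Carrier) where
    open Inverse e using (to; from; strictlyInverseˡ; strictlyInverseʳ)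

    nonzero : Fin n → Carrier
    nonzero = to ∘ punchIn (from 0#)

    nonzero≢0 : ∀ j → nonzero j ≢ 0#
    nonzero≢0 j eq = Fin.punchInᵢ≢i (from 0#) j (trans (sym (strictlyInverseʳ _)) (cong from eq))

    product-zero↦one : (g : Carrier → Carrier) → g 0# ≡ 0# → (∀ {x} → x ≢ 0# → g x ≢ 0#) →
                       Π.product (zero↦one ∘ g ∘ to) ≡ Π.product (g ∘ nonzero)
    product-zero↦one g g0≡0 g≢0 = begin
      Π.product (zero↦one ∘ g ∘ to)
        ≡⟨ Π.sum-remove {i = from 0#} (zero↦one ∘ g ∘ to) ⟩
      zero↦one (g (to (from 0#))) * Π.product (zero↦one ∘ g ∘ nonzero)
        ≡⟨ cong₂ _*_ (trans (cong (zero↦one ∘ g) (strictlyInverseˡ 0#)) (trans (cong zero↦one g0≡0) zero↦one-0#))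
                     (Π.sum-cong-≗ (zero↦one-nonzero ∘ g≢0 ∘ nonzero≢0)) ⟩
      1# * Π.product (g ∘ nonzero)
        ≡⟨ *-identityˡ _ ⟩
      Π.product (g ∘ nonzero) ∎
      where open ≡-Reasoning

    -- Multiplication by x permutes the field, and zero↦one lets the product over
    -- all elements see exactly the nonzero ones.
    pow-card-1≡1 : ∀ x → x ≢ 0# → pow x n ≡ 1#
    pow-card-1≡1 x x≢0 = sym (*-cancelʳ (Π.product nonzero) (product-nonzero nonzero nonzero≢0) (begin
      1# * Π.product nonzero              ≡⟨ *-identityˡ _ ⟩
      Π.product nonzero                   ≡⟨ product-zero↦one (λ y → y) refl (λ y≢0 → y≢0) ⟨
      Π.product (zero↦one ∘ to)           ≡⟨ sum-reindex *-commutativeMonoid e (*-bijection x x≢0) zero↦one ⟩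
      Π.product (zero↦one ∘ (x *_) ∘ to)  ≡⟨ product-zero↦one (x *_) (zeroʳ x) (*-nonzero x≢0) ⟩
      Π.product ((x *_) ∘ nonzero)        ≡⟨ Π.∑-distrib-+ (λ _ → x) nonzero ⟩
      Π.product {n} (λ _ → x) * Π.product nonzero  ≡⟨ cong (_* Π.product nonzero) (pow≡product x n) ⟨
      pow x n * Π.product nonzero         ∎))
      where open ≡-Reasoning

    card·1≡0 : suc n · 1# ≡ 0#
    card·1≡0 = sym (+-cancelʳ (sum to) 0# (suc n · 1#) (begin
      0# + sum to                   ≡⟨ +-identityˡ _ ⟩
      sum to                        ≡⟨ sum-reindex +-commutativeMonoid e (+-bijection 1#) (λ y → y) ⟩
      sum (λ i → to i + 1#)         ≡⟨ ∑-distrib-+ to (λ _ → 1#) ⟩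
      sum to + sum {suc n} (λ _ → 1#) ≡⟨ cong (sum to +_) (sum-replicate (suc n)) ⟩
      sum to + suc n · 1#           ≡⟨ +-comm _ _ ⟩
      suc n · 1# + sum to           ∎))
      where open ≡-Reasoning

    pow-pow≡1 : ∀ r ℓ → n ≡ r ℕ.* ℓ → ∀ x → x ≢ 0# → pow (pow x ℓ) r ≡ 1#
    pow-pow≡1 r ℓ n≡r*ℓ x x≢0 =
      trans (pow-* x ℓ r) (trans (cong (pow x) (trans (ℕ.*-comm ℓ r) (sym n≡r*ℓ))) (pow-card-1≡1 x x≢0))

    ∣card-1⇒·1≢0 : ∀ {r} → r ∣ n → r · 1# ≢ 0#
    ∣card-1⇒·1≢0 {r} (divides t n≡t*r) r·1≡0 = 1≢0 (begin
      1#                      ≡⟨ +-identityʳ 1# ⟨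
      1# + 0#                 ≡⟨ cong (1# +_) (zeroʳ (t · 1#)) ⟨
      1# + t · 1# * 0#        ≡⟨ cong (λ z → 1# + t · 1# * z) r·1≡0 ⟨
      1# + t · 1# * r · 1#    ≡⟨ cong (1# +_) (×1-homo-* t r) ⟨
      1# + (t ℕ.* r) · 1#     ≡⟨ cong (λ k → suc k · 1#) n≡t*r ⟨
      suc n · 1#              ≡⟨ card·1≡0 ⟩
      0#                      ∎)
      where open ≡-Reasoning

  geometric : Carrier → ℕ → Carrier
  geometric w k = sum {k} (λ i → pow w (toℕ i))

  geometric-1# : ∀ k → geometric 1# k ≡ k · 1#
  geometric-1# k = trans (sum-cong-≗ {k} (pow-1# ∘ toℕ)) (sum-replicate k)

  geometric-shift : ∀ w k → 1# + w * geometric w k ≡ geometric w k + pow w k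
  geometric-shift w k = begin
    1# + w * geometric w k                          ≡⟨ cong (1# +_) (*-distribˡ-sum {k} w _) ⟩
    geometric w (suc k)                             ≡⟨ sum-init-last {k} (λ i → pow w (toℕ i)) ⟩
    sum {k} (λ i → pow w (toℕ (inject₁ i))) + pow w (toℕ (fromℕ k))
      ≡⟨ cong₂ _+_ (sum-cong-≗ {k} (cong (pow w) ∘ Fin.toℕ-inject₁)) (cong (pow w) (Fin.toℕ-fromℕ k)) ⟩
    geometric w k + pow w k                         ∎
    where open ≡-Reasoning

  geometric≡0 : ∀ {w} k → pow w k ≡ 1# → w ≢ 1# → geometric w k ≡ 0#
  geometric≡0 {w} k wᵏ≡1 w≢1 with geometric w k ≟ 0#
  ... | yes G≡0 = G≡0
  ... | no  G≢0 = ⊥-elim (w≢1 (*-cancelʳ G G≢0 (begin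
    w * G   ≡⟨ +-cancelˡ 1# (w * G) (1# * G) (begin
                 1# + w * G   ≡⟨ geometric-shift w k ⟩
                 G + pow w k  ≡⟨ cong (G +_) wᵏ≡1 ⟩
                 G + 1#       ≡⟨ +-comm G 1# ⟩
                 1# + G       ≡⟨ cong (1# +_) (*-identityˡ G) ⟨
                 1# + 1# * G  ∎) ⟩
    1# * G  ∎)))
    where
    open ≡-Reasoning
    G = geometric w k

  -- If r · 1 ≠ 0, the powers of an element ζ of order r are all the r-th roots
  -- of unity.  For y not among them every y ζ⁻ᵏ is an r-th root of unity other
  -- than 1, so each geometric sum Σᵢ (y ζ⁻ᵏ)ⁱ vanishes; but summed over k
  -- these sums give r · 1 (orthogonality of characters).
  module RootsOfUnity {r′ : ℕ} (ζ : Carrier) (ζ-order : HasOrder ζ (suc r′)) (r·1≢0 : suc r′ · 1# ≢ 0#) where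
    private
      r = suc r′
      ζ⁻¹ = pow ζ r′

    pow-ζ*pow-ζ⁻¹ : ∀ j → pow ζ j * pow ζ⁻¹ j ≡ 1#
    pow-ζ*pow-ζ⁻¹ j = trans (sym (pow-distrib-* ζ ζ⁻¹ j))
                            (trans (cong (λ z → pow z j) (proj₁ (proj₂ (proj₂ ζ-order)))) (pow-1# j))

    pow-ζ⁻¹-root : ∀ j → pow (pow ζ⁻¹ j) r ≡ 1#
    pow-ζ⁻¹-root j = begin
      pow (pow ζ⁻¹ j) r             ≡⟨ pow-comm ζ⁻¹ j r ⟩
      pow (pow ζ⁻¹ r) j             ≡⟨ cong (λ z → pow z j) (*-identityˡ _) ⟨
      pow (1# * pow ζ⁻¹ r) j        ≡⟨ cong (λ z → pow (z * pow ζ⁻¹ r) j) (proj₁ (proj₂ (proj₂ ζ-order))) ⟨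
      pow (pow ζ r * pow ζ⁻¹ r) j   ≡⟨ cong (λ z → pow z j) (pow-ζ*pow-ζ⁻¹ r) ⟩
      pow 1# j                      ≡⟨ pow-1# j ⟩
      1#                            ∎
      where open ≡-Reasoning

    pow-ζ⁻¹≢1 : ∀ j → 1 ≤ j → j < r → pow ζ⁻¹ j ≢ 1#
    pow-ζ⁻¹≢1 j 1≤j j<r ζ⁻ʲ≡1 = proj₂ (proj₂ (proj₂ ζ-order)) j 1≤j j<r
      (trans (sym (*-identityʳ _)) (trans (cong (pow ζ j *_) (sym ζ⁻ʲ≡1)) (pow-ζ*pow-ζ⁻¹ j)))

    character-sum : ∀ y → sum {r} (λ k → geometric (y * pow ζ⁻¹ (toℕ k)) r) ≡ r · 1#
    character-sum y = begin
      sum {r} (λ k → sum {r} (λ i → pow (y * pow ζ⁻¹ (toℕ k)) (toℕ i)))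
        ≡⟨ sum-cong-≗ {r} (λ k → sum-cong-≗ {r} (term k)) ⟩
      sum {r} (λ k → sum {r} (λ i → pow y (toℕ i) * pow (pow ζ⁻¹ (toℕ i)) (toℕ k)))
        ≡⟨ ∑-comm {r} {r} (λ k i → pow y (toℕ i) * pow (pow ζ⁻¹ (toℕ i)) (toℕ k)) ⟩
      sum {r} (λ i → sum {r} (λ k → pow y (toℕ i) * pow (pow ζ⁻¹ (toℕ i)) (toℕ k)))
        ≡⟨ sum-cong-≗ {r} (λ i → *-distribˡ-sum {r} (pow y (toℕ i)) (λ k → pow (pow ζ⁻¹ (toℕ i)) (toℕ k))) ⟨
      sum {r} (λ i → pow y (toℕ i) * geometric (pow ζ⁻¹ (toℕ i)) r)
        ≡⟨ cong₂ _+_ (trans (*-identityˡ _) (geometric-1# r))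
                     (trans (sum-cong-≗ {r′} term-vanishes) (sum-replicate-zero r′)) ⟩
      r · 1# + 0#
        ≡⟨ +-identityʳ _ ⟩
      r · 1# ∎
      where
      open ≡-Reasoning
      term : ∀ k i → pow (y * pow ζ⁻¹ (toℕ k)) (toℕ i) ≡ pow y (toℕ i) * pow (pow ζ⁻¹ (toℕ i)) (toℕ k)
      term k i = trans (pow-distrib-* y _ (toℕ i)) (cong (pow y (toℕ i) *_) (pow-comm ζ⁻¹ (toℕ k) (toℕ i)))
      term-vanishes : ∀ (i : Fin r′) → pow y (suc (toℕ i)) * geometric (pow ζ⁻¹ (suc (toℕ i))) r ≡ 0#
      term-vanishes i = trans (cong (pow y (suc (toℕ i)) *_)
                               (geometric≡0 r (pow-ζ⁻¹-root (suc (toℕ i)))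
                                            (pow-ζ⁻¹≢1 (suc (toℕ i)) (s≤s z≤n) (s≤s (Fin.toℕ<n i)))))
                             (zeroʳ _)

    root⇒power : ∀ y → pow y r ≡ 1# → ∃ λ (k : Fin r) → y ≡ pow ζ (toℕ k)
    root⇒power y yʳ≡1 with Fin.any? (λ (k : Fin r) → y ≟ pow ζ (toℕ k))
    ... | yes found = found
    ... | no  none  = ⊥-elim (r·1≢0 (begin
      r · 1#                                               ≡⟨ character-sum y ⟨
      sum {r} (λ k → geometric (y * pow ζ⁻¹ (toℕ k)) r)    ≡⟨ sum-cong-≗ {r} (λ k → geometric≡0 r (root k) (≢1 k)) ⟩
      sum {r} (λ _ → 0#)                                   ≡⟨ sum-replicate-zero r ⟩
      0#                                                   ∎))
      where
      open ≡-Reasoning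
      root : ∀ k → pow (y * pow ζ⁻¹ (toℕ k)) r ≡ 1#
      root k = trans (pow-distrib-* y _ r) (trans (cong₂ _*_ yʳ≡1 (pow-ζ⁻¹-root (toℕ k))) (*-identityˡ 1#))
      ≢1 : ∀ k → y * pow ζ⁻¹ (toℕ k) ≢ 1#
      ≢1 k yζ⁻ᵏ≡1 = none (k , (begin
        y                                       ≡⟨ *-identityʳ y ⟨
        y * 1#                                  ≡⟨ cong (y *_) (trans (*-comm _ _) (pow-ζ*pow-ζ⁻¹ (toℕ k))) ⟨
        y * (pow ζ⁻¹ (toℕ k) * pow ζ (toℕ k))   ≡⟨ *-assoc y _ _ ⟨
        y * pow ζ⁻¹ (toℕ k) * pow ζ (toℕ k)     ≡⟨ cong (_* pow ζ (toℕ k)) yζ⁻ᵏ≡1 ⟩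
        1# * pow ζ (toℕ k)                      ≡⟨ *-identityˡ _ ⟩
        pow ζ (toℕ k)                           ∎))

  sumFin-cong : ∀ n {g h : Fin n → Carrier} → (∀ s → g s ≡ h s) → sumFin n g ≡ sumFin n h
  sumFin-cong zero    g≗h = refl
  sumFin-cong (suc n) g≗h = cong₂ _+_ (g≗h fzero) (sumFin-cong n (g≗h ∘ fsuc))

  evalPoly-pow : ∀ {r} (c : Fin r → Carrier) y k →
                 evalPoly c (pow y k) ≡ sumFin r (λ s → c s * pow y (k ℕ.* toℕ s))
  evalPoly-pow {r} c y k = sumFin-cong r (λ s → cong (c s *_) (pow-* y k (toℕ s)))

  module Twist (ℓ : ℕ) where
    twist : (Carrier → Carrier) → Carrier → Carrier
    twist P x = x * P (pow x ℓ)

    -- The multiplier of twist P is constant along the orbit of x as soon as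
    -- it is an ℓ-th root of unity.
    RootMultiplier : (Carrier → Carrier) → Set
    RootMultiplier P = ∀ x → x ≢ 0# → pow (P (pow x ℓ)) ℓ ≡ 1#

    pow-twist : ∀ P → RootMultiplier P → ∀ x → pow (twist P x) ℓ ≡ pow x ℓ
    pow-twist P root x with x ≟ 0#
    ... | yes refl = cong (λ z → pow z ℓ) (zeroˡ _)
    ... | no  x≢0  = trans (pow-distrib-* x _ ℓ) (trans (cong (pow x ℓ *_) (root x x≢0)) (*-identityʳ _))

    pow-iter-twist : ∀ P → RootMultiplier P → ∀ j x → pow (iter (twist P) j x) ℓ ≡ pow x ℓ
    pow-iter-twist P root zero    x = refl
    pow-iter-twist P root (suc j) x = trans (pow-twist P root _) (pow-iter-twist P root j x)

    iter-twist : ∀ P → RootMultiplier P → ∀ j x → iter (twist P) j x ≡ x * pow (P (pow x ℓ)) j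
    iter-twist P root zero    x = sym (*-identityʳ x)
    iter-twist P root (suc j) x = begin
      twist P (iter (twist P) j x)
        ≡⟨ cong₂ (λ y z → y * P z) (iter-twist P root j x) (pow-iter-twist P root j x) ⟩
      x * pow (P (pow x ℓ)) j * P (pow x ℓ)        ≡⟨ *-assoc x _ _ ⟩
      x * (pow (P (pow x ℓ)) j * P (pow x ℓ))      ≡⟨ cong (x *_) (*-comm _ _) ⟩
      x * pow (P (pow x ℓ)) (suc j)                ∎
      where open ≡-Reasoning

    module _ (P : Carrier → Carrier) {m : ℕ} (order : ∀ x → x ≢ 0# → HasOrder (P (pow x ℓ)) m) where
      private
        pow-m≡1 : ∀ x → x ≢ 0# → pow (P (pow x ℓ)) m ≡ 1#
        pow-m≡1 x x≢0 = proj₁ (proj₂ (proj₂ (order x x≢0)))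

        pow≢1 : ∀ x → x ≢ 0# → ∀ k → 1 ≤ k → k < m → pow (P (pow x ℓ)) k ≢ 1#
        pow≢1 x x≢0 = proj₂ (proj₂ (proj₂ (order x x≢0)))

      order⇒root-multiplier : m ∣ ℓ → RootMultiplier P
      order⇒root-multiplier (divides t refl) x x≢0 = begin
        pow (P (pow x ℓ)) (t ℕ.* m)      ≡⟨ cong (pow (P (pow x ℓ))) (ℕ.*-comm t m) ⟩
        pow (P (pow x ℓ)) (m ℕ.* t)      ≡⟨ pow-* _ m t ⟨
        pow (pow (P (pow x ℓ)) m) t      ≡⟨ cong (λ z → pow z t) (pow-m≡1 x x≢0) ⟩
        pow 1# t                         ≡⟨ pow-1# t ⟩
        1#                               ∎
        where open ≡-Reasoning

      module _ (m∣ℓ : m ∣ ℓ) where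
        private
          root = order⇒root-multiplier m∣ℓ

        iter-twist-period : ∀ x → iter (twist P) m x ≡ x
        iter-twist-period x with x ≟ 0#
        ... | yes refl = trans (iter-twist P root m 0#) (zeroˡ _)
        ... | no  x≢0  = trans (iter-twist P root m x) (trans (cong (x *_) (pow-m≡1 x x≢0)) (*-identityʳ x))

        twist-bijective : 1 ≤ m → Bijective _≡_ _≡_ (twist P)
        twist-bijective 1≤m = iter-periodic⇒bijective (twist P) m {{ℕ.>-nonZero 1≤m}} iter-twist-period

        twist-cycleType : 1 < m → CycleType1+m^ (twist P) m
        twist-cycleType 1<m = 0# , zeroˡ _ , fixed⇒0 , λ y y≢0 → iter-twist-period y , minimal y y≢0
          where
          iter≡id⇒pow≡1 : ∀ {y} k → y ≢ 0# → iter (twist P) k y ≡ y → pow (P (pow y ℓ)) k ≡ 1#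
          iter≡id⇒pow≡1 {y} k y≢0 iterᵏy≡y =
            *-cancelˡ y y≢0 (trans (sym (iter-twist P root k y)) (trans iterᵏy≡y (sym (*-identityʳ y))))
          fixed⇒0 : ∀ y → twist P y ≡ y → y ≡ 0#
          fixed⇒0 y twist-y≡y with y ≟ 0#
          ... | yes y≡0 = y≡0
          ... | no  y≢0 = ⊥-elim (pow≢1 y y≢0 1 ℕ.≤-refl 1<m (iter≡id⇒pow≡1 1 y≢0 twist-y≡y))
          minimal : ∀ y → y ≢ 0# → ∀ k → 1 ≤ k → k < m → iter (twist P) k y ≢ y
          minimal y y≢0 k 1≤k k<m = pow≢1 y y≢0 k 1≤k k<m ∘ iter≡id⇒pow≡1 k y≢0

    twist-inverseˡ : ∀ P Q → RootMultiplier P → (∀ x → x ≢ 0# → P (pow x ℓ) * Q (pow x ℓ) ≡ 1#) →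
                     ∀ x → twist Q (twist P x) ≡ x
    twist-inverseˡ P Q root inverse x with x ≟ 0#
    ... | yes refl = trans (cong (twist Q) (zeroˡ _)) (zeroˡ _)
    ... | no  x≢0  = begin
      x * P (pow x ℓ) * Q (pow (twist P x) ℓ)   ≡⟨ cong (λ z → twist P x * Q z) (pow-twist P root x) ⟩
      x * P (pow x ℓ) * Q (pow x ℓ)             ≡⟨ *-assoc x _ _ ⟩
      x * (P (pow x ℓ) * Q (pow x ℓ))           ≡⟨ cong (x *_) (inverse x x≢0) ⟩
      x * 1#                                    ≡⟨ *-identityʳ x ⟩
      x                                         ∎
      where open ≡-Reasoning

    inverse-root-multiplier : ∀ P Q → RootMultiplier P → (∀ x → x ≢ 0# → P (pow x ℓ) * Q (pow x ℓ) ≡ 1#) →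
                              RootMultiplier Q
    inverse-root-multiplier P Q root inverse x x≢0 = begin
      pow (Q (pow x ℓ)) ℓ                               ≡⟨ *-identityˡ _ ⟨
      1# * pow (Q (pow x ℓ)) ℓ                          ≡⟨ cong (_* pow (Q (pow x ℓ)) ℓ) (root x x≢0) ⟨
      pow (P (pow x ℓ)) ℓ * pow (Q (pow x ℓ)) ℓ         ≡⟨ pow-distrib-* _ _ ℓ ⟨
      pow (P (pow x ℓ) * Q (pow x ℓ)) ℓ                 ≡⟨ cong (λ z → pow z ℓ) (inverse x x≢0) ⟩
      pow 1# ℓ                                          ≡⟨ pow-1# ℓ ⟩
      1#                                                ∎
      where open ≡-Reasoning

    twist-inverse : ∀ P Q → RootMultiplier P → (∀ x → x ≢ 0# → P (pow x ℓ) * Q (pow x ℓ) ≡ 1#) →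
                    (∀ x → twist Q (twist P x) ≡ x) × (∀ x → twist P (twist Q x) ≡ x)
    twist-inverse P Q root inverse =
      twist-inverseˡ P Q root inverse ,
      twist-inverseˡ Q P (inverse-root-multiplier P Q root inverse) (λ x x≢0 → trans (*-comm _ _) (inverse x x≢0))

mainTheorem5 :
  (r q : ℕ) → 1 < r →
  (∃ λ p → ∃ λ k → Prime p × p ≢ 2 × 1 ≤ k × q ≡ p ^ k) →
  r ∣ (q ∸ 1) →
  (F : FiniteField q) →
  let open FiniteField F in
  (ζ : Carrier) → HasOrder ζ r →
  (m d : ℕ) → 1 ≤ m → 1 ≤ d → q ∸ 1 ≡ m ℕ.* d → r ∣ d → r ≤ φ m →
  (u : Fin r → Carrier) → (∀ k → HasOrder (u k) m) →
  (a : Fin r → Carrier) →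
  (∀ k → sumFin r (λ s → a s * pow ζ (toℕ k ℕ.* toℕ s)) ≡ u k) →
  (ℓ : ℕ) → q ∸ 1 ≡ r ℕ.* ℓ →
  let f : Carrier → Carrier
      f x = x * evalPoly a (pow x ℓ)
  in Bijective _≡_ _≡_ f
     × CycleType1+m^ f m
     × ((b : Fin r → Carrier) →
        (∀ k → u k *
                 (sumFin r (λ s → b s * pow ζ (toℕ k ℕ.* toℕ s)))
               ≡ 1#) →
        let g : Carrier → Carrier
            g x = x * evalPoly b (pow x ℓ)
        in (∀ x → g (f x) ≡ x) × (∀ x → f (g x) ≡ x))
mainTheorem5 (suc r′) zero _ _ _ F = ⊥-elim (Fin.¬Fin0 (Inverse.from (FiniteField.enum F) (FiniteField.0# F)))
mainTheorem5 (suc r′) (suc n) 1<r _ r∣n F ζ ζ-order m d 1≤m _ n≡m*d r∣d r≤φm u u-order a a↦u ℓ n≡r*ℓ =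
  twist-bijective P order m∣ℓ 1≤m ,
  twist-cycleType P order m∣ℓ (1<φ⇒1<n m (ℕ.<-≤-trans 1<r r≤φm)) ,
  λ b b↦u⁻¹ → twist-inverse P (evalPoly b) (order⇒root-multiplier P order m∣ℓ)
                (λ x x≢0 → trans (cong₂ _*_ (P-xˡ x x≢0) (evalPoly-xˡ b x x≢0)) (b↦u⁻¹ _))
  where
  open FiniteField F
  open FieldProperties F
  open Enumeration enum
  open RootsOfUnity ζ ζ-order (∣card-1⇒·1≢0 r∣n)
  open Twist ℓ
  P : Carrier → Carrier
  P = evalPoly a
  m∣ℓ : m ∣ ℓ
  m∣ℓ = r*ℓ≡m*d∧r∣d⇒m∣ℓ (trans (sym n≡r*ℓ) n≡m*d) r∣d
  power-of-ζ : ∀ x → x ≢ 0# → ∃ λ k → pow x ℓ ≡ pow ζ (toℕ k)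
  power-of-ζ x x≢0 = root⇒power (pow x ℓ) (pow-pow≡1 (suc r′) ℓ n≡r*ℓ x x≢0)
  evalPoly-xˡ : ∀ c x (x≢0 : x ≢ 0#) → let k = proj₁ (power-of-ζ x x≢0) in
                evalPoly c (pow x ℓ) ≡ sumFin (suc r′) (λ s → c s * pow ζ (toℕ k ℕ.* toℕ s))
  evalPoly-xˡ c x x≢0 = trans (cong (evalPoly c) (proj₂ (power-of-ζ x x≢0)))
                              (evalPoly-pow c ζ (toℕ (proj₁ (power-of-ζ x x≢0))))
  P-xˡ : ∀ x (x≢0 : x ≢ 0#) → P (pow x ℓ) ≡ u (proj₁ (power-of-ζ x x≢0))
  P-xˡ x x≢0 = trans (evalPoly-xˡ a x x≢0) (a↦u _)
  order : ∀ x → x ≢ 0# → HasOrder (P (pow x ℓ)) m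
  order x x≢0 = subst (λ z → HasOrder z m) (sym (P-xˡ x x≢0)) (u-order _)
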